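{- Let $\Lambda$ be an $ADE$ Dynkin diagram and $Q_\Lambda=Q(\Lambda\times\Lambda)$. The operations $\bar\mu_v$ ($v\in\mathrm{Vert}(\Lambda)$), acting on labeled quivers $(Q_\Lambda,\rho)$ with $\rho:\mathrm{Vert}(Q_\Lambda)\to\mathbb{R}_{>0}$, satisfy the relations of the Coxeter group of $\Lambda$: for distinct vertices $u,w$ of $\Lambda$, $(\bar\mu_u\circ\bar\mu_w)^3=\mathrm{id}$ if $u$ and $w$ are adjacent in $\Lambda$, and $(\bar\mu_u\circ\bar\mu_w)^2=\mathrm{id}$ otherwise.
   Context: A quiver is a finite directed graph without loops and directed 2-cycles. Mutation $\mu_v$: for each pair of arrows $u\to v$, $v\to w$ add an arrow $u\to w$; reverse all arrows incident to $v$; then repeatedly remove both arrows of any directed 2-cycle. A labeled quiver is a pair $(Q,\rho)$ with $\rho:\mathrm{Vert}(Q)\to\mathbb{R}_{>0}$; the labeled mutation is $\tilde\mu_v(Q,\rho)=(\mu_v(Q),\rho')$ with $\rho'(u)=\rho(u)$ for $u\ne v$ and $\rho'(v)\rho(v)=\prod_{u\to v}\rho(u)+\prod_{v\to w}\rho(w)$. Fix an $ADE$ Dynkin diagram $\Lambda$ with a bipartition $\epsilon:\mathrm{Vert}(\Lambda)\to\{0,1\}$. The quiver $Q_\Lambda$ has vertices $v_1,v_2$ for each vertex $v$ of $\Lambda$, and for each edge $\{u,w\}$ of $\Lambda$ with $\epsilon(u)=0,\epsilon(w)=1$ the arrows $u_1\to w_1$, $u_2\to w_2$, $w_2\to u_1$,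 $w_1\to u_2$. For a vertex $v$ of $\Lambda$, the swap $s_v$ on labeled quivers with vertex set $\mathrm{Vert}(Q_\Lambda)$ exchanges the labels of $v_1$ and $v_2$ and exchanges the roles of $v_1,v_2$ in the arrows (arrows not incident to $v_1,v_2$ unchanged). Define $\bar\mu_v=s_v\circ\tilde\mu_{v_1}\circ\tilde\mu_{v_2}$; each $\bar\mu_v$ maps labeled quivers with underlying quiver $Q_\Lambda$ to labeled quivers with underlying quiver $Q_\Lambda$. -}

module Defs where

open import Level using (0ℓ)
open import Data.Nat as ℕ using (ℕ; zero; suc; _∸_; _≡ᵇ_)
open import Data.Bool using (Bool; true; false; _∧_; _∨_; not; if_then_else_)
open import Data.Fin using (Fin; toℕ; splitAt; join; _↑ˡ_; _↑ʳ_)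
import Data.Fin as Fin
open import Data.Sum using (_⊎_; inj₁; inj₂)
open import Data.Product using (_×_; _,_; proj₁; proj₂; Σ; ∃)
open import Data.List using (List; []; _∷_; map; upTo; _++_)
open import Data.Bool.ListAction using (any)
open import Relation.Nullary using (¬_; does)
open import Relation.Binary.PropositionalEquality using (_≡_; _≢_)

-- The real numbers, axiomatised as a complete ordered field
-- (unique up to isomorphism).  Equality is propositional equality;
-- the multiplicative inverse is total, specified only on nonzero x.

record RealField : Set₁ where
  infixl 6 _+_
  infixl 7 _*_
  infix  4 _<_
  field
    Carrier : Set
    0# 1#   : Carrier
    _+_ _*_ : Carrier → Carrier → Carrier
    -_      : Carrier → Carrier
    _⁻¹     : Carrier → Carrier
    _<_     : Carrier → Carrier → Set
    +-assoc  : ∀ x y z → (x + y) + z ≡ x + (y + z)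
    +-comm   : ∀ x y → x + y ≡ y + x
    +-identityˡ : ∀ x → 0# + x ≡ x
    -‿inverseˡ : ∀ x → (- x) + x ≡ 0#
    *-assoc  : ∀ x y z → (x * y) * z ≡ x * (y * z)
    *-comm   : ∀ x y → x * y ≡ y * x
    *-identityˡ : ∀ x → 1# * x ≡ x
    distribˡ : ∀ x y z → x * (y + z) ≡ x * y + x * z
    ⁻¹-inverseʳ : ∀ x → x ≢ 0# → x * (x ⁻¹) ≡ 1#
    0≢1      : 0# ≢ 1#
    <-irrefl : ∀ x → ¬ (x < x)
    <-trans  : ∀ x y z → x < y → y < z → x < z
    <-trichotomy : ∀ x y → (x < y) ⊎ (x ≡ y) ⊎ (y < x)
    +-mono-< : ∀ x y z → x < y → x + z < y + z
    *-pos    : ∀ x y → 0# < x → 0# < y → 0# < x * y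
    complete : (P : Carrier → Set) → (∃ λ x → P x) →
               (∃ λ b → ∀ x → P x → (x < b ⊎ x ≡ b)) →
               ∃ λ s → (∀ x → P x → (x < s ⊎ x ≡ s)) ×
                       (∀ b → (∀ x → P x → (x < b ⊎ x ≡ b)) → (s < b ⊎ s ≡ b))

-- Quivers on the vertex set Fin m, given by arrow multiplicities:
-- Q i j = number of arrows i → j.

Quiver : ℕ → Set
Quiver m = Fin m → Fin m → ℕ

_≟F_ : ∀ {m} → Fin m → Fin m → Bool
i ≟F j = does (i Fin.≟ j)

-- Quiver mutation at k: reverse arrows at k; for i,j ≠ k add
-- Q i k * Q k j arrows i → j, then cancel directed 2-cycles.
mutate : ∀ {m} → Fin m → Quiver m → Quiver m
mutate k Q i j =
  if (i ≟F k) ∨ (j ≟F k) then Q j i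
  else ((Q i j ℕ.+ Q i k ℕ.* Q k j) ∸ (Q j i ℕ.+ Q j k ℕ.* Q k i))

module Labeled (R : RealField) where
  open RealField R

  pow : Carrier → ℕ → Carrier
  pow x zero    = 1#
  pow x (suc n) = x * pow x n

  prod : ∀ m → (Fin m → Carrier) → Carrier
  prod zero    f = 1#
  prod (suc m) f = f Fin.zero * prod m (λ i → f (Fin.suc i))

  LabeledQuiver : ℕ → Set
  LabeledQuiver m = Quiver m × (Fin m → Carrier)

  lmutate : ∀ {m} → Fin m → LabeledQuiver m → LabeledQuiver m
  lmutate {m} k (Q , ρ) = mutate k Q , ρ'
    where
    ρ' : Fin m → Carrier
    ρ' i = if i ≟F k
           then (prod m (λ u → pow (ρ u) (Q u k)) + prod m (λ w → pow (ρ w) (Q k w))) * (ρ k ⁻¹)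
           else ρ i

  -- relabel a labeled quiver along a map σ on vertices
  -- (used with an involution σ: vertex x takes the role of σ x)
  relabel : ∀ {m} → (Fin m → Fin m) → LabeledQuiver m → LabeledQuiver m
  relabel σ (Q , ρ) = (λ i j → Q (σ i) (σ j)) , (λ i → ρ (σ i))

data ADE : Set where
  A : ℕ → ADE   -- A n  is  A_{n+1}
  D : ℕ → ADE   -- D n  is  D_{n+4}
  E₆ E₇ E₈ : ADE

rank : ADE → ℕ
rank (A n) = suc n
rank (D n) = n ℕ.+ 4
rank E₆ = 6
rank E₇ = 7
rank E₈ = 8

pathEdges : ℕ → List (ℕ × ℕ)
pathEdges k = map (λ i → i , suc i) (upTo (k ∸ 1))

edges : ADE → List (ℕ × ℕ)
edges (A n) = pathEdges (suc n)
edges (D n) = pathEdges (n ℕ.+ 3) ++ ((n ℕ.+ 1 , n ℕ.+ 3) ∷ [])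
edges E₆ = pathEdges 5 ++ ((2 , 5) ∷ [])
edges E₇ = pathEdges 6 ++ ((2 , 6) ∷ [])
edges E₈ = pathEdges 7 ++ ((2 , 7) ∷ [])

adjacent : (t : ADE) → Fin (rank t) → Fin (rank t) → Bool
adjacent t u w = any (λ e → ((proj₁ e ≡ᵇ toℕ u) ∧ (proj₂ e ≡ᵇ toℕ w))
                          ∨ ((proj₁ e ≡ᵇ toℕ w) ∧ (proj₂ e ≡ᵇ toℕ u))) (edges t)

-- ε : Vert(Λ) → {0,1} with false = 0, true = 1
IsBipartition : (t : ADE) → (Fin (rank t) → Bool) → Set
IsBipartition t ε = ∀ u w → adjacent t u w ≡ true → ε u ≢ ε w

-- The quiver Q_Λ on Fin (n + n): v₁ = v ↑ˡ n, v₂ = n ↑ʳ v.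

copy₁ : ∀ {n} → Fin n → Fin (n ℕ.+ n)
copy₁ {n} v = v ↑ˡ n

copy₂ : ∀ {n} → Fin n → Fin (n ℕ.+ n)
copy₂ {n} v = n ↑ʳ v

QΛ : (t : ADE) → (Fin (rank t) → Bool) → Quiver (rank t ℕ.+ rank t)
QΛ t ε x y = go (splitAt (rank t) x) (splitAt (rank t) y)
  where
  arrow : Bool → Fin (rank t) → Bool → Fin (rank t) → ℕ
  -- c, d : copy (false = copy 1, true = copy 2)
  arrow c p d q =
    if adjacent t p q ∧
       ((not (ε p) ∧ ε q ∧ (c Data.Bool.≟ d |> does)) ∨
        (ε p ∧ not (ε q) ∧ not (c Data.Bool.≟ d |> does)))
    then 1 else 0
    where open import Function using (_|>_)
  go : Fin (rank t) ⊎ Fin (rank t) → Fin (rank t) ⊎ Fin (rank t) → ℕ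
  go (inj₁ p) (inj₁ q) = arrow false p false q
  go (inj₁ p) (inj₂ q) = arrow false p true q
  go (inj₂ p) (inj₁ q) = arrow true p false q
  go (inj₂ p) (inj₂ q) = arrow true p true q

swapPerm : ∀ {n} → Fin n → Fin (n ℕ.+ n) → Fin (n ℕ.+ n)
swapPerm {n} v x = join n n (sw (splitAt n x))
  where
  sw : Fin n ⊎ Fin n → Fin n ⊎ Fin n
  sw (inj₁ p) = if p ≟F v then inj₂ p else inj₁ p
  sw (inj₂ p) = if p ≟F v then inj₁ p else inj₂ p

module Bar (R : RealField) (t : ADE) where
  open Labeled R

  μbar : Fin (rank t) → LabeledQuiver (rank t ℕ.+ rank t) → LabeledQuiver (rank t ℕ.+ rank t)
  μbar v L = relabel (swapPerm v) (lmutate (copy₁ v) (lmutate (copy₂ v) L))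

iterate : ∀ {A : Set} → ℕ → (A → A) → A → A
iterate zero    f a = a
iterate (suc k) f a = f (iterate k f a)

coxeterOrder : (t : ADE) → Fin (rank t) → Fin (rank t) → ℕ
coxeterOrder t u w = if adjacent t u w then 3 else 2

-- Mutating Q_Λ at v₂ and then at v₁ and swapping the two copies gives Q_Λ back, because v₂
-- mirrors v₁: the arrows out of v₁ are the arrows into v₂ and vice versa.  On labels, μ̄_v
-- therefore replaces ρ(v₁), ρ(v₂) by N_v/ρ(v₂), N_v/ρ(v₁), where N_v is the exchange binomial
-- ∏_{x→v₁} ρ(x) + ∏_{v₁→x} ρ(x).  N_v does not involve the labels at v₁, v₂, and the copies of a
-- neighbour w of v are joined to v₁ by one arrow into and one arrow out of v₁, so N_v is
-- homogeneous of degree δ = [v adjacent to w] in the labels at w₁, w₂.  Hence the orbit of ρ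
-- under μ̄_u ∘ μ̄_w consists of the labelings that scale ρ by λ at u₁, u₂ and by μ at w₁, w₂,
-- with (λ, μ) ↦ (λ', μ') given by the monomial recurrence μ'μ = λ^δ c, λ'λ = μ'^δ d for
-- constants c, d > 0.  Starting from (1, 1) it runs through (dc, c), (d, dc), (1, 1) when δ = 1
-- and through (d, c), (1, 1) when δ = 0.

module Submission where

open import Defs
open import Level using (0ℓ)
open import Data.Nat as ℕ using (ℕ; zero; suc; _∸_)
import Data.Nat.Properties as ℕₚ
open import Data.Bool using (Bool; true; false; _∧_; _∨_; not; if_then_else_)
import Data.Bool as Bool
import Data.Bool.Properties as Boolₚ
open import Data.Bool.ListAction using (or)
open import Data.List.Properties using (map-cong)
open import Data.Fin using (Fin; splitAt; join)
import Data.Fin as Fin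
import Data.Fin.Properties as Finₚ
open import Data.Vec.Functional using (updateAt)
open import Data.Vec.Functional.Properties using (updateAt-updates; updateAt-minimal; updateAt-id-local)
open import Data.Product using (_×_; _,_; proj₁; proj₂)
open import Data.Sum using (_⊎_; inj₁; inj₂)
import Data.Sum as Sum
open import Data.Empty using (⊥-elim)
open import Relation.Nullary using (yes; no; Dec; does)
open import Relation.Nullary.Decidable using (dec-true; dec-false)
open import Relation.Binary.PropositionalEquality
open import Function using (_∘_)
open import Algebra.Bundles using (CommutativeRing)
open import Algebra.Structures using (IsCommutativeRing)
import Algebra.Properties.Ring as RingProperties

module OrderedFieldProperties (R : RealField) where
  open RealField R

  +-identityʳ : ∀ x → x + 0# ≡ x
  +-identityʳ x = trans (+-comm x 0#) (+-identityˡ x)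

  *-identityʳ : ∀ x → x * 1# ≡ x
  *-identityʳ x = trans (*-comm x 1#) (*-identityˡ x)

  -‿inverseʳ : ∀ x → x + (- x) ≡ 0#
  -‿inverseʳ x = trans (+-comm x (- x)) (-‿inverseˡ x)

  distribʳ : ∀ x y z → (y + z) * x ≡ y * x + z * x
  distribʳ x y z = trans (*-comm (y + z) x)
    (trans (distribˡ x y z) (cong₂ _+_ (*-comm x y) (*-comm x z)))

  isCommutativeRing : IsCommutativeRing _≡_ _+_ _*_ -_ 0# 1#
  isCommutativeRing = record
    { isRing = record
      { +-isAbelianGroup = record
        { isGroup = record
          { isMonoid = record
            { isSemigroup = record
              { isMagma = record { isEquivalence = isEquivalence ; ∙-cong = cong₂ _+_ }
              ; assoc = +-assoc }
            ; identity = +-identityˡ , +-identityʳ }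
          ; inverse = -‿inverseˡ , -‿inverseʳ
          ; ⁻¹-cong = cong -_ }
        ; comm = +-comm }
      ; *-cong = cong₂ _*_
      ; *-assoc = *-assoc
      ; *-identity = *-identityˡ , *-identityʳ
      ; distrib = distribˡ , distribʳ }
    ; *-comm = *-comm }

  commutativeRing : CommutativeRing 0ℓ 0ℓ
  commutativeRing = record { isCommutativeRing = isCommutativeRing }

  open import Algebra.Solver.Ring.NaturalCoefficients.Default
    (CommutativeRing.commutativeSemiring commutativeRing) public

  private
    open module ℝ = RingProperties (CommutativeRing.ring commutativeRing)
      using (-‿distribˡ-*; -‿distribʳ-*; -‿involutive)
    open CommutativeRing commutativeRing using (zeroʳ)

  pos⇒≢0 : ∀ {x} → 0# < x → x ≢ 0#
  pos⇒≢0 {x} 0<x x≡0 = <-irrefl 0# (subst (0# <_) x≡0 0<x)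

  neg⇒-pos : ∀ {x} → x < 0# → 0# < - x
  neg⇒-pos {x} x<0 = subst₂ _<_ (-‿inverseʳ x) (+-identityˡ (- x)) (+-mono-< x 0# (- x) x<0)

  +-pos : ∀ {x y} → 0# < x → 0# < y → 0# < x + y
  +-pos {x} {y} 0<x 0<y =
    <-trans 0# y (x + y) 0<y (subst (_< x + y) (+-identityˡ y) (+-mono-< 0# x y 0<x))

  0<1 : 0# < 1#
  0<1 with <-trichotomy 0# 1#
  ... | inj₁ 0<1 = 0<1
  ... | inj₂ (inj₁ 0≡1) = ⊥-elim (0≢1 0≡1)
  ... | inj₂ (inj₂ 1<0) = ⊥-elim (<-irrefl 0# (<-trans 0# 1# 0# 0<[-1]² 1<0))
    where
    0<[-1]² : 0# < 1#
    0<[-1]² = subst (0# <_) (trans (sym (-‿distribˡ-* 1# (- 1#)))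
                          (trans (cong -_ (*-identityˡ (- 1#))) (-‿involutive 1#)))
                (*-pos (- 1#) (- 1#) (neg⇒-pos 1<0) (neg⇒-pos 1<0))

  ⁻¹-pos : ∀ {x} → 0# < x → 0# < x ⁻¹
  ⁻¹-pos {x} 0<x with <-trichotomy 0# (x ⁻¹)
  ... | inj₁ 0<x⁻¹ = 0<x⁻¹
  ... | inj₂ (inj₁ 0≡x⁻¹) =
    ⊥-elim (0≢1 (trans (sym (zeroʳ x)) (trans (cong (x *_) 0≡x⁻¹) (⁻¹-inverseʳ x (pos⇒≢0 0<x)))))
  ... | inj₂ (inj₂ x⁻¹<0) = ⊥-elim (<-irrefl 0# (<-trans 0# 1# 0# 0<1 1<0))
    where
    0<-1 : 0# < - 1#
    0<-1 = subst (0# <_) (trans (sym (-‿distribʳ-* x (x ⁻¹))) (cong -_ (⁻¹-inverseʳ x (pos⇒≢0 0<x))))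
                 (*-pos x (- (x ⁻¹)) 0<x (neg⇒-pos x⁻¹<0))
    1<0 : 1# < 0#
    1<0 = subst₂ _<_ (+-identityˡ 1#) (-‿inverseˡ 1#) (+-mono-< 0# (- 1#) 1# 0<-1)

  *⁻¹-unique : ∀ {x y z} → y ≢ 0# → z * y ≡ x → x * y ⁻¹ ≡ z
  *⁻¹-unique {x} {y} {z} y≢0 zy≡x = begin
    x * y ⁻¹         ≡⟨ cong (_* y ⁻¹) (sym zy≡x) ⟩
    z * y * y ⁻¹     ≡⟨ *-assoc z y (y ⁻¹) ⟩
    z * (y * y ⁻¹)   ≡⟨ cong (z *_) (⁻¹-inverseʳ y y≢0) ⟩
    z * 1#           ≡⟨ *-identityʳ z ⟩
    z                ∎
    where open ≡-Reasoning

  *⁻¹-cancelʳ : ∀ {x y} → y ≢ 0# → x * y ⁻¹ * y ≡ x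
  *⁻¹-cancelʳ {x} {y} y≢0 = begin
    x * y ⁻¹ * y     ≡⟨ *-assoc x (y ⁻¹) y ⟩
    x * (y ⁻¹ * y)   ≡⟨ cong (x *_) (trans (*-comm (y ⁻¹) y) (⁻¹-inverseʳ y y≢0)) ⟩
    x * 1#           ≡⟨ *-identityʳ x ⟩
    x                ∎
    where open ≡-Reasoning

≟F-refl : ∀ {m} (i : Fin m) → (i ≟F i) ≡ true
≟F-refl i = dec-true (i Fin.≟ i) refl

≟F-≢ : ∀ {m} {i j : Fin m} → i ≢ j → (i ≟F j) ≡ false
≟F-≢ {i = i} {j} i≢j = dec-false (i Fin.≟ j) i≢j

m∸n+n≡m⊔n : ∀ m n → m ∸ n ℕ.+ n ≡ m ℕ.⊔ n
m∸n+n≡m⊔n m n with ℕₚ.≤-total m n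
... | inj₁ m≤n = trans (cong (ℕ._+ n) (ℕₚ.m≤n⇒m∸n≡0 m≤n)) (sym (ℕₚ.m≤n⇒m⊔n≡n m≤n))
... | inj₂ n≤m = trans (ℕₚ.m∸n+n≡m n≤m) (sym (ℕₚ.m≥n⇒m⊔n≡m n≤m))

m∸[n+o]+o≡[m⊔[n+o]]∸n : ∀ m n o → m ∸ (n ℕ.+ o) ℕ.+ o ≡ m ℕ.⊔ (n ℕ.+ o) ∸ n
m∸[n+o]+o≡[m⊔[n+o]]∸n m n o = begin
  m ∸ (n ℕ.+ o) ℕ.+ o                 ≡⟨ sym (ℕₚ.m+n∸n≡m _ n) ⟩
  m ∸ (n ℕ.+ o) ℕ.+ o ℕ.+ n ∸ n       ≡⟨ cong (_∸ n) (trans (ℕₚ.+-assoc (m ∸ (n ℕ.+ o)) o n)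
                                            (cong (m ∸ (n ℕ.+ o) ℕ.+_) (ℕₚ.+-comm o n))) ⟩
  m ∸ (n ℕ.+ o) ℕ.+ (n ℕ.+ o) ∸ n     ≡⟨ cong (_∸ n) (m∸n+n≡m⊔n m (n ℕ.+ o)) ⟩
  m ℕ.⊔ (n ℕ.+ o) ∸ n                 ∎
  where open ≡-Reasoning

-- The number of arrows i → j after μ_k ∘ μ_k', where a = #(i → j), b = #(j → i) and p, q count
-- the paths i → k' → j and j → k' → i (μ_k' turns these into paths j → k → i and i → k → j).
mutate-twice-count : ∀ a b p q → a ≡ 0 ⊎ b ≡ 0 →
  ((a ℕ.+ p) ∸ (b ℕ.+ q) ℕ.+ q) ∸ ((b ℕ.+ q) ∸ (a ℕ.+ p) ℕ.+ p) ≡ a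
mutate-twice-count a b p q a≡0⊎b≡0
  rewrite m∸[n+o]+o≡[m⊔[n+o]]∸n (a ℕ.+ p) b q | m∸[n+o]+o≡[m⊔[n+o]]∸n (b ℕ.+ q) a p
        | ℕₚ.⊔-comm (b ℕ.+ q) (a ℕ.+ p) with a≡0⊎b≡0
... | inj₁ refl = ℕₚ.m≤n⇒m∸n≡0 (ℕₚ.m∸n≤m (p ℕ.⊔ (b ℕ.+ q)) b)
... | inj₂ refl = ℕₚ.m∸[m∸n]≡n (ℕₚ.≤-trans (ℕₚ.m≤m+n a p) (ℕₚ.m≤m⊔n _ _))

module _ {m : ℕ} (Q : Quiver m) (k : Fin m) where

  mutate-atˡ : ∀ j → mutate k Q k j ≡ Q j k
  mutate-atˡ j rewrite ≟F-refl k = refl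

  mutate-atʳ : ∀ i → mutate k Q i k ≡ Q k i
  mutate-atʳ i rewrite ≟F-refl k | Boolₚ.∨-zeroʳ (i ≟F k) = refl

  mutate-away : ∀ {i j} → i ≢ k → j ≢ k →
    mutate k Q i j ≡ (Q i j ℕ.+ Q i k ℕ.* Q k j) ∸ (Q j i ℕ.+ Q j k ℕ.* Q k i)
  mutate-away i≢k j≢k rewrite ≟F-≢ i≢k | ≟F-≢ j≢k = refl

  mutate-diag : Q k k ≡ 0 → ∀ i → mutate k Q i i ≡ 0
  mutate-diag Qkk≡0 i with i Fin.≟ k
  ... | yes refl = Qkk≡0
  ... | no _    = ℕₚ.n∸n≡0 (Q i i ℕ.+ Q i k ℕ.* Q k i)

record Mirror {m} (Q : Quiver m) (k k' : Fin m) : Set where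
  field
    distinct   : k ≢ k'
    no-2-cycle : ∀ i j → Q i j ≡ 0 ⊎ Q j i ≡ 0
    out≡in'    : ∀ j → Q k j ≡ Q j k'
    in≡out'    : ∀ j → Q j k ≡ Q k' j

  diag : ∀ i → Q i i ≡ 0
  diag i with no-2-cycle i i
  ... | inj₁ Qii≡0 = Qii≡0
  ... | inj₂ Qii≡0 = Qii≡0

  kk'≡0 : Q k k' ≡ 0
  kk'≡0 = trans (out≡in' k') (diag k')

  k'k≡0 : Q k' k ≡ 0
  k'k≡0 = trans (in≡out' k') (diag k')

Mirror-cong : ∀ {m} {Q Q' : Quiver m} {k k'} → (∀ i j → Q i j ≡ Q' i j) → Mirror Q' k k' → Mirror Q k k'
Mirror-cong {k = k} {k'} Q≗Q' M = record
  { distinct   = distinct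
  ; no-2-cycle = λ i j → Sum.map (trans (Q≗Q' i j)) (trans (Q≗Q' j i)) (no-2-cycle i j)
  ; out≡in'    = λ j → trans (Q≗Q' k j) (trans (out≡in' j) (sym (Q≗Q' j k')))
  ; in≡out'    = λ j → trans (Q≗Q' j k) (trans (in≡out' j) (sym (Q≗Q' k' j)))
  }
  where open Mirror M

record IsSwap {m} (σ : Fin m → Fin m) (k k' : Fin m) : Set where
  field
    σ-k    : σ k ≡ k'
    σ-k'   : σ k' ≡ k
    σ-fix  : ∀ x → x ≢ k → x ≢ k' → σ x ≡ x

data Role {m} (k k' : Fin m) : Fin m → Set where
  at-k    : Role k k' k
  at-k'   : Role k k' k'
  elsewhere : ∀ {x} → x ≢ k → x ≢ k' → Role k k' x

role : ∀ {m} (k k' x : Fin m) → Role k k' x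
role k k' x with x Fin.≟ k | x Fin.≟ k'
... | yes refl | _        = at-k
... | no _     | yes refl = at-k'
... | no x≢k   | no x≢k'  = elsewhere x≢k x≢k'

module MirrorMutation {m} {Q : Quiver m} {k k' : Fin m} (M : Mirror Q k k') where
  open Mirror M

  Q₁ Q₂ : Quiver m
  Q₁ = mutate k' Q
  Q₂ = mutate k Q₁

  k'≢k : k' ≢ k
  k'≢k = distinct ∘ sym

  ∸-absorb : ∀ {a b} → a ≡ 0 ⊎ b ≡ 0 → a ∸ b ≡ a
  ∸-absorb {b = b} (inj₁ refl) = ℕₚ.0∸n≡0 b
  ∸-absorb         (inj₂ refl) = refl

  Q₁-into-k : ∀ i → i ≢ k' → Q₁ i k ≡ Q i k
  Q₁-into-k i i≢k' rewrite mutate-away Q k' i≢k' distinct | k'k≡0 | kk'≡0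
                         | ℕₚ.*-zeroʳ (Q i k') | ℕₚ.+-identityʳ (Q i k) | ℕₚ.+-identityʳ (Q k i)
    = ∸-absorb (no-2-cycle i k)

  Q₁-out-of-k : ∀ j → j ≢ k' → Q₁ k j ≡ Q k j
  Q₁-out-of-k j j≢k' rewrite mutate-away Q k' distinct j≢k' | k'k≡0 | kk'≡0
                           | ℕₚ.*-zeroʳ (Q j k') | ℕₚ.+-identityʳ (Q k j) | ℕₚ.+-identityʳ (Q j k)
    = ∸-absorb (no-2-cycle k j)

  Q₂-diag : ∀ i → Q₂ i i ≡ 0
  Q₂-diag = mutate-diag Q₁ k (trans (Q₁-into-k k distinct) (diag k))

  Q₂-k'k≡0 : Q₂ k' k ≡ 0
  Q₂-k'k≡0 = trans (mutate-atʳ Q₁ k k') (trans (mutate-atʳ Q k' k) k'k≡0)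

  Q₂-kk'≡0 : Q₂ k k' ≡ 0
  Q₂-kk'≡0 = trans (mutate-atˡ Q₁ k k') (trans (mutate-atˡ Q k' k) kk'≡0)

  Q₂-out-of-k : ∀ j → j ≢ k' → Q₂ k j ≡ Q k' j
  Q₂-out-of-k j j≢k' = trans (mutate-atˡ Q₁ k j) (trans (Q₁-into-k j j≢k') (in≡out' j))

  Q₂-into-k : ∀ i → i ≢ k' → Q₂ i k ≡ Q i k'
  Q₂-into-k i i≢k' = trans (mutate-atʳ Q₁ k i) (trans (Q₁-out-of-k i i≢k') (out≡in' i))

  Q₂-out-of-k' : ∀ j → j ≢ k → j ≢ k' → Q₂ k' j ≡ Q k j
  Q₂-out-of-k' j j≢k j≢k' = begin
    Q₂ k' j                                                   ≡⟨ mutate-away Q₁ k k'≢k j≢k ⟩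
    (Q₁ k' j ℕ.+ Q₁ k' k ℕ.* Q₁ k j) ∸ (Q₁ j k' ℕ.+ Q₁ j k ℕ.* Q₁ k k')
      ≡⟨ cong₂ (λ a b → (Q₁ k' j ℕ.+ a ℕ.* Q₁ k j) ∸ (Q₁ j k' ℕ.+ Q₁ j k ℕ.* b))
               (trans (mutate-atˡ Q k' k) kk'≡0) (trans (mutate-atʳ Q k' k) k'k≡0) ⟩
    (Q₁ k' j ℕ.+ 0) ∸ (Q₁ j k' ℕ.+ Q₁ j k ℕ.* 0)
      ≡⟨ cong₂ _∸_ (ℕₚ.+-identityʳ (Q₁ k' j))
                   (trans (cong (Q₁ j k' ℕ.+_) (ℕₚ.*-zeroʳ (Q₁ j k))) (ℕₚ.+-identityʳ (Q₁ j k'))) ⟩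
    Q₁ k' j ∸ Q₁ j k'                                         ≡⟨ cong₂ _∸_ (mutate-atˡ Q k' j) (mutate-atʳ Q k' j) ⟩
    Q j k' ∸ Q k' j                                           ≡⟨ ∸-absorb (no-2-cycle j k') ⟩
    Q j k'                                                    ≡⟨ sym (out≡in' j) ⟩
    Q k j                                                     ∎
    where open ≡-Reasoning

  Q₂-into-k' : ∀ i → i ≢ k → i ≢ k' → Q₂ i k' ≡ Q i k
  Q₂-into-k' i i≢k i≢k' = begin
    Q₂ i k'                                                   ≡⟨ mutate-away Q₁ k i≢k k'≢k ⟩
    (Q₁ i k' ℕ.+ Q₁ i k ℕ.* Q₁ k k') ∸ (Q₁ k' i ℕ.+ Q₁ k' k ℕ.* Q₁ k i)
      ≡⟨ cong₂ (λ a b → (Q₁ i k' ℕ.+ Q₁ i k ℕ.* a) ∸ (Q₁ k' i ℕ.+ b ℕ.* Q₁ k i))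
               (trans (mutate-atʳ Q k' k) k'k≡0) (trans (mutate-atˡ Q k' k) kk'≡0) ⟩
    (Q₁ i k' ℕ.+ Q₁ i k ℕ.* 0) ∸ (Q₁ k' i ℕ.+ 0)
      ≡⟨ cong₂ _∸_ (trans (cong (Q₁ i k' ℕ.+_) (ℕₚ.*-zeroʳ (Q₁ i k))) (ℕₚ.+-identityʳ (Q₁ i k')))
                   (ℕₚ.+-identityʳ (Q₁ k' i)) ⟩
    Q₁ i k' ∸ Q₁ k' i                                         ≡⟨ cong₂ _∸_ (mutate-atʳ Q k' i) (mutate-atˡ Q k' i) ⟩
    Q k' i ∸ Q i k'                                           ≡⟨ ∸-absorb (no-2-cycle k' i) ⟩
    Q k' i                                                    ≡⟨ sym (in≡out' i) ⟩
    Q i k                                                     ∎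
    where open ≡-Reasoning

  Q₂-away : ∀ i j → i ≢ k → i ≢ k' → j ≢ k → j ≢ k' → Q₂ i j ≡ Q i j
  Q₂-away i j i≢k i≢k' j≢k j≢k' = begin
    Q₂ i j                                                    ≡⟨ mutate-away Q₁ k i≢k j≢k ⟩
    (Q₁ i j ℕ.+ Q₁ i k ℕ.* Q₁ k j) ∸ (Q₁ j i ℕ.+ Q₁ j k ℕ.* Q₁ k i)
      ≡⟨ cong₂ (λ a b → (Q₁ i j ℕ.+ a) ∸ (Q₁ j i ℕ.+ b)) (through-k i j i≢k' j≢k') (through-k j i j≢k' i≢k') ⟩
    (Q₁ i j ℕ.+ q) ∸ (Q₁ j i ℕ.+ p)
      ≡⟨ cong₂ (λ a b → (a ℕ.+ q) ∸ (b ℕ.+ p)) (mutate-away Q k' i≢k' j≢k') (mutate-away Q k' j≢k' i≢k') ⟩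
    ((Q i j ℕ.+ p) ∸ (Q j i ℕ.+ q) ℕ.+ q) ∸ ((Q j i ℕ.+ q) ∸ (Q i j ℕ.+ p) ℕ.+ p)
      ≡⟨ mutate-twice-count (Q i j) (Q j i) p q (no-2-cycle i j) ⟩
    Q i j                                                     ∎
    where
    open ≡-Reasoning
    p q : ℕ
    p = Q i k' ℕ.* Q k' j
    q = Q j k' ℕ.* Q k' i
    through-k : ∀ a b → a ≢ k' → b ≢ k' → Q₁ a k ℕ.* Q₁ k b ≡ Q b k' ℕ.* Q k' a
    through-k a b a≢k' b≢k' = trans (cong₂ ℕ._*_ (trans (Q₁-into-k a a≢k') (in≡out' a))
                                                  (trans (Q₁-out-of-k b b≢k') (out≡in' b)))
                                     (ℕₚ.*-comm (Q k' a) (Q b k'))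

  open IsSwap

  mutate-mutate-swap : ∀ {σ} → IsSwap σ k k' → ∀ i j → Q₂ (σ i) (σ j) ≡ Q i j
  mutate-mutate-swap {σ} S i j with role k k' i | role k k' j
  ... | at-k | at-k rewrite σ-k S = trans (Q₂-diag k') (sym (diag k))
  ... | at-k | at-k' rewrite σ-k S | σ-k' S = trans Q₂-k'k≡0 (sym kk'≡0)
  ... | at-k | elsewhere j≢k j≢k' rewrite σ-k S | σ-fix S j j≢k j≢k' = Q₂-out-of-k' j j≢k j≢k'
  ... | at-k' | at-k rewrite σ-k S | σ-k' S = trans Q₂-kk'≡0 (sym k'k≡0)
  ... | at-k' | at-k' rewrite σ-k' S = trans (Q₂-diag k) (sym (diag k'))
  ... | at-k' | elsewhere j≢k j≢k' rewrite σ-k' S | σ-fix S j j≢k j≢k' = Q₂-out-of-k j j≢k'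
  ... | elsewhere i≢k i≢k' | at-k rewrite σ-k S | σ-fix S i i≢k i≢k' = Q₂-into-k' i i≢k i≢k'
  ... | elsewhere i≢k i≢k' | at-k' rewrite σ-k' S | σ-fix S i i≢k i≢k' = Q₂-into-k i i≢k'
  ... | elsewhere i≢k i≢k' | elsewhere j≢k j≢k' rewrite σ-fix S i i≢k i≢k' | σ-fix S j j≢k j≢k' =
    Q₂-away i j i≢k i≢k' j≢k j≢k'

module ExchangeRelation (R : RealField) where
  open RealField R
  open Labeled R
  open OrderedFieldProperties R

  Labels : ℕ → Set
  Labels m = Fin m → Carrier

  prod-cong : ∀ m {f g : Fin m → Carrier} → (∀ i → f i ≡ g i) → prod m f ≡ prod m g
  prod-cong zero    f≗g = refl
  prod-cong (suc m) f≗g = cong₂ _*_ (f≗g Fin.zero) (prod-cong m (f≗g ∘ Fin.suc))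

  prod-pos : ∀ m {f : Fin m → Carrier} → (∀ i → 0# < f i) → 0# < prod m f
  prod-pos zero    f-pos = 0<1
  prod-pos (suc m) f-pos = *-pos _ _ (f-pos Fin.zero) (prod-pos m (f-pos ∘ Fin.suc))

  prod-updateAt : ∀ m (f : Fin m → Carrier) p s → prod m (updateAt f p (s *_)) ≡ s * prod m f
  prod-updateAt (suc m) f Fin.zero    s = *-assoc s _ _
  prod-updateAt (suc m) f (Fin.suc p) s = begin
    f Fin.zero * prod m (updateAt (f ∘ Fin.suc) p (s *_)) ≡⟨ cong (f Fin.zero *_) (prod-updateAt m (f ∘ Fin.suc) p s) ⟩
    f Fin.zero * (s * prod m (f ∘ Fin.suc))               ≡⟨ solve 3 (λ a s b → a :* (s :* b) := s :* (a :* b)) refl (f Fin.zero) s _ ⟩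
    s * (f Fin.zero * prod m (f ∘ Fin.suc))               ∎
    where open ≡-Reasoning

  pow-pos : ∀ {x} e → 0# < x → 0# < pow x e
  pow-pos zero    0<x = 0<1
  pow-pos (suc e) 0<x = *-pos _ _ 0<x (pow-pos e 0<x)

  pow-distrib-* : ∀ x y e → pow (x * y) e ≡ pow x e * pow y e
  pow-distrib-* x y zero    = sym (*-identityˡ 1#)
  pow-distrib-* x y (suc e) = begin
    x * y * pow (x * y) e         ≡⟨ cong (x * y *_) (pow-distrib-* x y e) ⟩
    x * y * (pow x e * pow y e)   ≡⟨ solve 4 (λ x y a b → x :* y :* (a :* b) := x :* a :* (y :* b)) refl x y (pow x e) (pow y e) ⟩
    x * pow x e * (y * pow y e)   ∎
    where open ≡-Reasoning

  pow-+ : ∀ x a b → pow x (a ℕ.+ b) ≡ pow x a * pow x b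
  pow-+ x zero    b = sym (*-identityˡ (pow x b))
  pow-+ x (suc a) b = trans (cong (x *_) (pow-+ x a b)) (sym (*-assoc x (pow x a) (pow x b)))

  monomial : ∀ {m} → Labels m → (Fin m → ℕ) → Carrier
  monomial {m} ρ e = prod m (λ y → pow (ρ y) (e y))

  monomial-pos : ∀ {m} {ρ : Labels m} e → (∀ x → 0# < ρ x) → 0# < monomial ρ e
  monomial-pos {m} e ρ-pos = prod-pos m (λ y → pow-pos (e y) (ρ-pos y))

  scaleAt : ∀ {m} → Fin m → Carrier → Labels m → Labels m
  scaleAt p s ρ = updateAt ρ p (s *_)

  monomial-scaleAt : ∀ {m} (ρ : Labels m) e p s → monomial (scaleAt p s ρ) e ≡ pow s (e p) * monomial ρ e
  monomial-scaleAt {m} ρ e p s = trans (prod-cong m factor) (prod-updateAt m _ p (pow s (e p)))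
    where
    factor : ∀ y → pow (scaleAt p s ρ y) (e y) ≡ updateAt (λ y → pow (ρ y) (e y)) p (pow s (e p) *_) y
    factor y with y Fin.≟ p
    ... | yes refl = trans (cong (λ z → pow z (e y)) (updateAt-updates y ρ))
                      (trans (pow-distrib-* s (ρ y) (e y)) (sym (updateAt-updates y _)))
    ... | no y≢p = trans (cong (λ z → pow z (e y)) (updateAt-minimal y p ρ y≢p)) (sym (updateAt-minimal y p _ y≢p))

  binomial : ∀ {m} → Quiver m → Fin m → Labels m → Carrier
  binomial Q k ρ = monomial ρ (λ u → Q u k) + monomial ρ (Q k)

  binomial-pos : ∀ {m} (Q : Quiver m) k {ρ} → (∀ x → 0# < ρ x) → 0# < binomial Q k ρ
  binomial-pos Q k ρ-pos = +-pos (monomial-pos (λ u → Q u k) ρ-pos) (monomial-pos (Q k) ρ-pos)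

  exchange : ∀ {m} → Quiver m → Fin m → Fin m → Labels m → Labels m
  exchange Q k k' ρ x =
    if x ≟F k then binomial Q k ρ * ρ k' ⁻¹
    else if x ≟F k' then binomial Q k ρ * ρ k ⁻¹
    else ρ x

  module _ {m} (Q : Quiver m) {k k' : Fin m} (k≢k' : k ≢ k') (ρ : Labels m) where

    exchange-at-k : exchange Q k k' ρ k ≡ binomial Q k ρ * ρ k' ⁻¹
    exchange-at-k rewrite ≟F-refl k = refl

    exchange-at-k' : exchange Q k k' ρ k' ≡ binomial Q k ρ * ρ k ⁻¹
    exchange-at-k' rewrite ≟F-≢ (k≢k' ∘ sym) | ≟F-refl k' = refl

    exchange-away : ∀ {x} → x ≢ k → x ≢ k' → exchange Q k k' ρ x ≡ ρ x
    exchange-away x≢k x≢k' rewrite ≟F-≢ x≢k | ≟F-≢ x≢k' = refl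

  binomial-cong : ∀ {m} {Q Q' : Quiver m} {k} {ρ ρ' : Labels m} →
    (∀ i j → Q i j ≡ Q' i j) → (∀ x → ρ x ≡ ρ' x) → binomial Q k ρ ≡ binomial Q' k ρ'
  binomial-cong {m} {k = k} Q≗Q' ρ≗ρ' =
    cong₂ _+_ (prod-cong m (λ u → cong₂ pow (ρ≗ρ' u) (Q≗Q' u k)))
              (prod-cong m (λ u → cong₂ pow (ρ≗ρ' u) (Q≗Q' k u)))

  exchange-cong : ∀ {m} {Q Q' : Quiver m} {k k'} {ρ ρ' : Labels m} →
    (∀ i j → Q i j ≡ Q' i j) → (∀ x → ρ x ≡ ρ' x) → ∀ x → exchange Q k k' ρ x ≡ exchange Q' k k' ρ' x
  exchange-cong {k = k} {k'} Q≗Q' ρ≗ρ' x with x ≟F k | x ≟F k'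
  ... | true  | _     = cong₂ _*_ (binomial-cong Q≗Q' ρ≗ρ') (cong _⁻¹ (ρ≗ρ' k'))
  ... | false | true  = cong₂ _*_ (binomial-cong Q≗Q' ρ≗ρ') (cong _⁻¹ (ρ≗ρ' k))
  ... | false | false = ρ≗ρ' x

  module LabeledMirrorMutation {m} {Q : Quiver m} {k k'} (M : Mirror Q k k') (ρ : Labels m) where
    open Mirror M
    open MirrorMutation M using (Q₁; Q₁-into-k; Q₁-out-of-k; k'≢k)
    open IsSwap

    ρ₁ ρ₂ : Labels m
    ρ₁ = proj₂ (lmutate k' (Q , ρ))
    ρ₂ = proj₂ (lmutate k (Q₁ , ρ₁))

    ρ₁-at-k' : ρ₁ k' ≡ binomial Q k' ρ * ρ k' ⁻¹
    ρ₁-at-k' rewrite ≟F-refl k' = refl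

    ρ₁-away : ∀ {x} → x ≢ k' → ρ₁ x ≡ ρ x
    ρ₁-away x≢k' rewrite ≟F-≢ x≢k' = refl

    ρ₂-at-k : ρ₂ k ≡ binomial Q₁ k ρ₁ * ρ₁ k ⁻¹
    ρ₂-at-k rewrite ≟F-refl k = refl

    ρ₂-away : ∀ {x} → x ≢ k → ρ₂ x ≡ ρ₁ x
    ρ₂-away x≢k rewrite ≟F-≢ x≢k = refl

    binomial-at-k' : binomial Q k' ρ ≡ binomial Q k ρ
    binomial-at-k' = trans (cong₂ _+_ (prod-cong m (λ u → cong (pow (ρ u)) (sym (out≡in' u))))
                                      (prod-cong m (λ u → cong (pow (ρ u)) (sym (in≡out' u)))))
                           (+-comm _ _)

    binomial-after-k' : binomial Q₁ k ρ₁ ≡ binomial Q k ρ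
    binomial-after-k' = cong₂ _+_ (prod-cong m (λ u → into u (u Fin.≟ k')))
                                  (prod-cong m (λ u → out-of u (u Fin.≟ k')))
      where
      into : ∀ u → Dec (u ≡ k') → pow (ρ₁ u) (Q₁ u k) ≡ pow (ρ u) (Q u k)
      into u (yes refl) = trans (cong (pow (ρ₁ k')) (trans (mutate-atˡ Q k' k) kk'≡0))
                                (sym (cong (pow (ρ k')) k'k≡0))
      into u (no u≢k')  = cong₂ pow (ρ₁-away u≢k') (Q₁-into-k u u≢k')
      out-of : ∀ u → Dec (u ≡ k') → pow (ρ₁ u) (Q₁ k u) ≡ pow (ρ u) (Q k u)
      out-of u (yes refl) = trans (cong (pow (ρ₁ k')) (trans (mutate-atʳ Q k' k) k'k≡0))
                                  (sym (cong (pow (ρ k')) kk'≡0))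
      out-of u (no u≢k')  = cong₂ pow (ρ₁-away u≢k') (Q₁-out-of-k u u≢k')

    lmutate-lmutate-swap : ∀ {σ} → IsSwap σ k k' → ∀ x → ρ₂ (σ x) ≡ exchange Q k k' ρ x
    lmutate-lmutate-swap S x with role k k' x
    ... | at-k rewrite σ-k S = begin
      ρ₂ k'                      ≡⟨ ρ₂-away k'≢k ⟩
      ρ₁ k'                      ≡⟨ ρ₁-at-k' ⟩
      binomial Q k' ρ * ρ k' ⁻¹  ≡⟨ cong (_* ρ k' ⁻¹) binomial-at-k' ⟩
      binomial Q k ρ * ρ k' ⁻¹   ≡⟨ exchange-at-k Q distinct ρ ⟨
      exchange Q k k' ρ k        ∎
      where open ≡-Reasoning
    ... | at-k' rewrite σ-k' S = begin
      ρ₂ k                       ≡⟨ ρ₂-at-k ⟩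
      binomial Q₁ k ρ₁ * ρ₁ k ⁻¹ ≡⟨ cong₂ (λ b r → b * r ⁻¹) binomial-after-k' (ρ₁-away distinct) ⟩
      binomial Q k ρ * ρ k ⁻¹    ≡⟨ exchange-at-k' Q distinct ρ ⟨
      exchange Q k k' ρ k'       ∎
      where open ≡-Reasoning
    ... | elsewhere x≢k x≢k' rewrite σ-fix S x x≢k x≢k' =
      trans (ρ₂-away x≢k) (trans (ρ₁-away x≢k') (sym (exchange-away Q distinct ρ x≢k x≢k')))

  scalePair : ∀ {m} → Fin m → Fin m → Carrier → Labels m → Labels m
  scalePair k k' s ρ = scaleAt k s (scaleAt k' s ρ)

  monomial-scalePair : ∀ {m} (ρ : Labels m) e k k' s →
    monomial (scalePair k k' s ρ) e ≡ pow s (e k ℕ.+ e k') * monomial ρ e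
  monomial-scalePair ρ e k k' s = begin
    monomial (scalePair k k' s ρ) e                 ≡⟨ monomial-scaleAt (scaleAt k' s ρ) e k s ⟩
    pow s (e k) * monomial (scaleAt k' s ρ) e       ≡⟨ cong (pow s (e k) *_) (monomial-scaleAt ρ e k' s) ⟩
    pow s (e k) * (pow s (e k') * monomial ρ e)     ≡⟨ *-assoc _ _ _ ⟨
    pow s (e k) * pow s (e k') * monomial ρ e       ≡⟨ cong (_* monomial ρ e) (pow-+ s (e k) (e k')) ⟨
    pow s (e k ℕ.+ e k') * monomial ρ e             ∎
    where open ≡-Reasoning

  binomial-scalePair : ∀ {m} (Q : Quiver m) k {p q n} → Q p k ℕ.+ Q q k ≡ n → Q k p ℕ.+ Q k q ≡ n →
    ∀ s ρ → binomial Q k (scalePair p q s ρ) ≡ pow s n * binomial Q k ρ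
  binomial-scalePair Q k {p} {q} {n} into≡n out≡n s ρ = begin
    binomial Q k (scalePair p q s ρ)
      ≡⟨ cong₂ _+_ (monomial-scalePair ρ (λ u → Q u k) p q s) (monomial-scalePair ρ (Q k) p q s) ⟩
    pow s (Q p k ℕ.+ Q q k) * monomial ρ (λ u → Q u k) + pow s (Q k p ℕ.+ Q k q) * monomial ρ (Q k)
      ≡⟨ cong₂ (λ a b → pow s a * monomial ρ (λ u → Q u k) + pow s b * monomial ρ (Q k)) into≡n out≡n ⟩
    pow s n * monomial ρ (λ u → Q u k) + pow s n * monomial ρ (Q k)
      ≡⟨ distribˡ _ _ _ ⟨
    pow s n * binomial Q k ρ
      ∎
    where open ≡-Reasoning

  module _ {m} {k k' : Fin m} (k≢k' : k ≢ k') (s : Carrier) (ρ : Labels m) where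

    scalePair-at-k : scalePair k k' s ρ k ≡ s * ρ k
    scalePair-at-k = trans (updateAt-updates k _) (cong (s *_) (updateAt-minimal k k' ρ k≢k'))

    scalePair-at-k' : scalePair k k' s ρ k' ≡ s * ρ k'
    scalePair-at-k' = trans (updateAt-minimal k' k _ (k≢k' ∘ sym)) (updateAt-updates k' ρ)

    scalePair-away : ∀ {x} → x ≢ k → x ≢ k' → scalePair k k' s ρ x ≡ ρ x
    scalePair-away {x} x≢k x≢k' = trans (updateAt-minimal x k _ x≢k) (updateAt-minimal x k' ρ x≢k')

  scalePair-one : ∀ {m} k k' (ρ : Labels m) x → scalePair k k' 1# ρ x ≡ ρ x
  scalePair-one k k' ρ x = trans (updateAt-id-local k _ (*-identityˡ _) x) (updateAt-id-local k' ρ (*-identityˡ _) x)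

  exchange-scalePair : ∀ {m} (Q : Quiver m) {k k'} (k≢k' : k ≢ k') {s s'} (ρ : Labels m) →
    0# < s → 0# < ρ k → 0# < ρ k' →
    s' * s * (ρ k * ρ k') ≡ binomial Q k (scalePair k k' s ρ) →
    ∀ x → exchange Q k k' (scalePair k k' s ρ) x ≡ scalePair k k' s' ρ x
  exchange-scalePair Q {k} {k'} k≢k' {s} {s'} ρ 0<s 0<ρk 0<ρk' s's≡N x with role k k' x
  ... | at-k = begin
    exchange Q k k' ρ' k   ≡⟨ exchange-at-k Q k≢k' ρ' ⟩
    N * ρ' k' ⁻¹           ≡⟨ cong (λ r → N * r ⁻¹) (scalePair-at-k' k≢k' s ρ) ⟩
    N * (s * ρ k') ⁻¹      ≡⟨ *⁻¹-unique (pos⇒≢0 (*-pos _ _ 0<s 0<ρk'))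
                                (trans (solve 4 (λ s' ρk s ρk' → s' :* ρk :* (s :* ρk') := s' :* s :* (ρk :* ρk'))
                                                refl s' (ρ k) s (ρ k')) s's≡N) ⟩
    s' * ρ k               ≡⟨ scalePair-at-k k≢k' s' ρ ⟨
    scalePair k k' s' ρ k  ∎
    where
    open ≡-Reasoning
    ρ' : Labels _
    ρ' = scalePair k k' s ρ
    N : Carrier
    N = binomial Q k ρ'
  ... | at-k' = begin
    exchange Q k k' ρ' k'  ≡⟨ exchange-at-k' Q k≢k' ρ' ⟩
    N * ρ' k ⁻¹            ≡⟨ cong (λ r → N * r ⁻¹) (scalePair-at-k k≢k' s ρ) ⟩
    N * (s * ρ k) ⁻¹       ≡⟨ *⁻¹-unique (pos⇒≢0 (*-pos _ _ 0<s 0<ρk))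
                                (trans (solve 4 (λ s' ρk' s ρk → s' :* ρk' :* (s :* ρk) := s' :* s :* (ρk :* ρk'))
                                                refl s' (ρ k') s (ρ k)) s's≡N) ⟩
    s' * ρ k'              ≡⟨ scalePair-at-k' k≢k' s' ρ ⟨
    scalePair k k' s' ρ k' ∎
    where
    open ≡-Reasoning
    ρ' : Labels _
    ρ' = scalePair k k' s ρ
    N : Carrier
    N = binomial Q k ρ'
  ... | elsewhere x≢k x≢k' =
    trans (exchange-away Q k≢k' _ x≢k x≢k')
          (trans (scalePair-away k≢k' s ρ x≢k x≢k') (sym (scalePair-away k≢k' s' ρ x≢k x≢k')))

adjacent-sym : ∀ t p q → adjacent t p q ≡ adjacent t q p
adjacent-sym t p q = cong or (map-cong (λ e → Boolₚ.∨-comm (test e p q) (test e q p)) (edges t))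
  where
  test : ℕ × ℕ → Fin (rank t) → Fin (rank t) → Bool
  test e p q = (proj₁ e ℕ.≡ᵇ Fin.toℕ p) ∧ (proj₂ e ℕ.≡ᵇ Fin.toℕ q)

adjacency : (t : ADE) → Fin (rank t) → Fin (rank t) → ℕ
adjacency t v w = if adjacent t v w then 1 else 0

-- The number of arrows (copy c of p) → (copy d of q) in Q_Λ; copy false is v₁, copy true is v₂.
arrowCount : (adj εp εq c d : Bool) → ℕ
arrowCount adj εp εq c d =
  if adj ∧ ((not εp ∧ εq ∧ does (c Bool.≟ d)) ∨ (εp ∧ not εq ∧ not (does (c Bool.≟ d)))) then 1 else 0

arrowCount-no-2-cycle : ∀ adj εp εq c d → arrowCount adj εp εq c d ≡ 0 ⊎ arrowCount adj εq εp d c ≡ 0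
arrowCount-no-2-cycle false _     _     _     _     = inj₁ refl
arrowCount-no-2-cycle true  false false _     _     = inj₁ refl
arrowCount-no-2-cycle true  true  true  _     _     = inj₁ refl
arrowCount-no-2-cycle true  false true  false false = inj₂ refl
arrowCount-no-2-cycle true  false true  false true  = inj₁ refl
arrowCount-no-2-cycle true  false true  true  false = inj₁ refl
arrowCount-no-2-cycle true  false true  true  true  = inj₂ refl
arrowCount-no-2-cycle true  true  false false false = inj₁ refl
arrowCount-no-2-cycle true  true  false false true  = inj₂ refl
arrowCount-no-2-cycle true  true  false true  false = inj₂ refl
arrowCount-no-2-cycle true  true  false true  true  = inj₁ refl

arrowCount-mirror-out : ∀ adj εv εq d → arrowCount adj εv εq false d ≡ arrowCount adj εq εv d true
arrowCount-mirror-out false _     _     _     = refl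
arrowCount-mirror-out true  false false _     = refl
arrowCount-mirror-out true  true  true  _     = refl
arrowCount-mirror-out true  false true  false = refl
arrowCount-mirror-out true  false true  true  = refl
arrowCount-mirror-out true  true  false false = refl
arrowCount-mirror-out true  true  false true  = refl

arrowCount-mirror-in : ∀ adj εv εq d → arrowCount adj εq εv d false ≡ arrowCount adj εv εq true d
arrowCount-mirror-in false _     _     _     = refl
arrowCount-mirror-in true  false false _     = refl
arrowCount-mirror-in true  true  true  _     = refl
arrowCount-mirror-in true  false true  false = refl
arrowCount-mirror-in true  false true  true  = refl
arrowCount-mirror-in true  true  false false = refl
arrowCount-mirror-in true  true  false true  = refl

arrowCount-from-copies : ∀ adj εp εq d → (adj ≡ true → εp ≢ εq) →
  arrowCount adj εp εq false d ℕ.+ arrowCount adj εp εq true d ≡ (if adj then 1 else 0)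
arrowCount-from-copies false _     _     _     _     = refl
arrowCount-from-copies true  false false _     εp≢εq = ⊥-elim (εp≢εq refl refl)
arrowCount-from-copies true  true  true  _     εp≢εq = ⊥-elim (εp≢εq refl refl)
arrowCount-from-copies true  false true  false _     = refl
arrowCount-from-copies true  false true  true  _     = refl
arrowCount-from-copies true  true  false false _     = refl
arrowCount-from-copies true  true  false true  _     = refl

arrowCount-to-copies : ∀ adj εp εq d → (adj ≡ true → εp ≢ εq) →
  arrowCount adj εq εp d false ℕ.+ arrowCount adj εq εp d true ≡ (if adj then 1 else 0)
arrowCount-to-copies false _     _     _     _     = refl
arrowCount-to-copies true  false false _     εp≢εq = ⊥-elim (εp≢εq refl refl)
arrowCount-to-copies true  true  true  _     εp≢εq = ⊥-elim (εp≢εq refl refl)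
arrowCount-to-copies true  false true  false _     = refl
arrowCount-to-copies true  false true  true  _     = refl
arrowCount-to-copies true  true  false false _     = refl
arrowCount-to-copies true  true  false true  _     = refl

module QuiverΛ (t : ADE) (ε : Fin (rank t) → Bool) where

  copy : Bool → Fin (rank t) → Fin (rank t ℕ.+ rank t)
  copy false = copy₁
  copy true  = copy₂

  data CopyView : Fin (rank t ℕ.+ rank t) → Set where
    copy-of : ∀ c p → CopyView (copy c p)

  copyView : ∀ x → CopyView x
  copyView x = subst CopyView (Finₚ.join-splitAt (rank t) (rank t) x) (fromSplit (splitAt (rank t) x))
    where
    fromSplit : ∀ s → CopyView (join (rank t) (rank t) s)
    fromSplit (inj₁ p) = copy-of false p
    fromSplit (inj₂ p) = copy-of true p

  splitAt-copy : ∀ c p → splitAt (rank t) (copy c p) ≡ (if c then inj₂ p else inj₁ p)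
  splitAt-copy false p = Finₚ.splitAt-↑ˡ (rank t) p (rank t)
  splitAt-copy true  p = Finₚ.splitAt-↑ʳ (rank t) (rank t) p

  copy-injective : ∀ {c d p q} → copy c p ≡ copy d q → c ≡ d × p ≡ q
  copy-injective {c} {d} {p} {q} eq
    with trans (sym (splitAt-copy c p)) (trans (cong (splitAt (rank t)) eq) (splitAt-copy d q))
  copy-injective {false} {false} _ | refl = refl , refl
  copy-injective {true}  {true}  _ | refl = refl , refl

  copies-distinct : ∀ c d {p q} → p ≢ q → copy c p ≢ copy d q
  copies-distinct c d p≢q = p≢q ∘ proj₂ ∘ copy-injective {c} {d}

  QΛ-copy : ∀ c p d q → QΛ t ε (copy c p) (copy d q) ≡ arrowCount (adjacent t p q) (ε p) (ε q) c d
  QΛ-copy c p d q rewrite splitAt-copy c p | splitAt-copy d q with c | d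
  ... | false | false = refl
  ... | false | true  = refl
  ... | true  | false = refl
  ... | true  | true  = refl

  mirrorΛ : ∀ v → Mirror (QΛ t ε) (copy false v) (copy true v)
  mirrorΛ v = record
    { distinct   = λ eq → false≢true (proj₁ (copy-injective {false} {true} eq))
    ; no-2-cycle = no-2-cycle
    ; out≡in'    = out≡in'
    ; in≡out'    = in≡out'
    }
    where
    false≢true : false ≢ true
    false≢true ()
    no-2-cycle : ∀ i j → QΛ t ε i j ≡ 0 ⊎ QΛ t ε j i ≡ 0
    no-2-cycle i j with copyView i | copyView j
    ... | copy-of c p | copy-of d q rewrite QΛ-copy c p d q | QΛ-copy d q c p | adjacent-sym t q p =
      arrowCount-no-2-cycle (adjacent t p q) (ε p) (ε q) c d
    out≡in' : ∀ j → QΛ t ε (copy false v) j ≡ QΛ t ε j (copy true v)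
    out≡in' j with copyView j
    ... | copy-of d q rewrite QΛ-copy false v d q | QΛ-copy d q true v | adjacent-sym t q v =
      arrowCount-mirror-out (adjacent t v q) (ε v) (ε q) d
    in≡out' : ∀ j → QΛ t ε j (copy false v) ≡ QΛ t ε (copy true v) j
    in≡out' j with copyView j
    ... | copy-of d q rewrite QΛ-copy d q false v | QΛ-copy true v d q | adjacent-sym t q v =
      arrowCount-mirror-in (adjacent t v q) (ε v) (ε q) d

  swapPerm-isSwap : ∀ v → IsSwap (swapPerm v) (copy false v) (copy true v)
  swapPerm-isSwap v = record { σ-k = σ-k ; σ-k' = σ-k' ; σ-fix = σ-fix }
    where
    σ-k : swapPerm v (copy false v) ≡ copy true v
    σ-k rewrite splitAt-copy false v | ≟F-refl v = refl
    σ-k' : swapPerm v (copy true v) ≡ copy false v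
    σ-k' rewrite splitAt-copy true v | ≟F-refl v = refl
    σ-fix : ∀ x → x ≢ copy false v → x ≢ copy true v → swapPerm v x ≡ x
    σ-fix x x≢v₁ x≢v₂ with copyView x
    ... | copy-of false p rewrite splitAt-copy false p | ≟F-≢ (x≢v₁ ∘ cong (copy false)) = refl
    ... | copy-of true  p rewrite splitAt-copy true  p | ≟F-≢ (x≢v₂ ∘ cong (copy true)) = refl

  module _ (bip : IsBipartition t ε) where

    QΛ-from-copies : ∀ v w d → QΛ t ε (copy false v) (copy d w) ℕ.+ QΛ t ε (copy true v) (copy d w) ≡ adjacency t v w
    QΛ-from-copies v w d rewrite QΛ-copy false v d w | QΛ-copy true v d w =
      arrowCount-from-copies (adjacent t v w) (ε v) (ε w) d (bip v w)

    QΛ-to-copies : ∀ v w d → QΛ t ε (copy d w) (copy false v) ℕ.+ QΛ t ε (copy d w) (copy true v) ≡ adjacency t v w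
    QΛ-to-copies v w d rewrite QΛ-copy d w false v | QΛ-copy d w true v | adjacent-sym t w v =
      arrowCount-to-copies (adjacent t v w) (ε v) (ε w) d (bip v w)

    adjacency-irrefl : ∀ v → adjacency t v v ≡ 0
    adjacency-irrefl v with adjacent t v v in adj
    ... | true  = ⊥-elim (bip v v adj refl)
    ... | false = refl

module LabelDynamics (R : RealField) (t : ADE) (ε : Fin (rank t) → Bool) (bip : IsBipartition t ε) where
  open RealField R
  open Labeled R
  open OrderedFieldProperties R
  open ExchangeRelation R
  open QuiverΛ t ε

  n : ℕ
  n = rank t ℕ.+ rank t

  exchangeΛ : Fin (rank t) → Labels n → Labels n
  exchangeΛ v = exchange (QΛ t ε) (copy false v) (copy true v)

  exchangeΛ-cong : ∀ v {ρ ρ'} → (∀ x → ρ x ≡ ρ' x) → ∀ x → exchangeΛ v ρ x ≡ exchangeΛ v ρ' x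
  exchangeΛ-cong v = exchange-cong {Q = QΛ t ε} (λ _ _ → refl)

  coxeterElement : Fin (rank t) → Fin (rank t) → Labels n → Labels n
  coxeterElement u w = exchangeΛ u ∘ exchangeΛ w

  _≅Λ_ : LabeledQuiver n → Labels n → Set
  L ≅Λ ρ = (∀ i j → proj₁ L i j ≡ QΛ t ε i j) × (∀ x → proj₂ L x ≡ ρ x)

  μbar-≅Λ : ∀ v {L ρ} → L ≅Λ ρ → Bar.μbar R t v L ≅Λ exchangeΛ v ρ
  μbar-≅Λ v {Q , ρ'} (Q≗QΛ , ρ'≗ρ) =
    (λ i j → trans (mutate-mutate-swap (swapPerm-isSwap v) i j) (Q≗QΛ i j)) ,
    (λ x → trans (lmutate-lmutate-swap (swapPerm-isSwap v) x) (exchange-cong Q≗QΛ ρ'≗ρ x))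
    where
    M : Mirror Q (copy false v) (copy true v)
    M = Mirror-cong Q≗QΛ (mirrorΛ v)
    open MirrorMutation M using (mutate-mutate-swap)
    open LabeledMirrorMutation M ρ' using (lmutate-lmutate-swap)

  iterate-≅Λ : ∀ u w K {L ρ} → L ≅Λ ρ →
    iterate K (Bar.μbar R t u ∘ Bar.μbar R t w) L ≅Λ iterate K (coxeterElement u w) ρ
  iterate-≅Λ u w zero    L≅ρ = L≅ρ
  iterate-≅Λ u w (suc K) L≅ρ = μbar-≅Λ u (μbar-≅Λ w (iterate-≅Λ u w K L≅ρ))

  Positive : Labels n → Set
  Positive ρ = ∀ x → 0# < ρ x

  scale : Fin (rank t) → Carrier → Labels n → Labels n
  scale v = scalePair (copy false v) (copy true v)

  copies-of-v-distinct : ∀ v → copy false v ≢ copy true v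
  copies-of-v-distinct v = Mirror.distinct (mirrorΛ v)

  scale-at-copy : ∀ v s ρ c → scale v s ρ (copy c v) ≡ s * ρ (copy c v)
  scale-at-copy v s ρ false = scalePair-at-k (copies-of-v-distinct v) s ρ
  scale-at-copy v s ρ true  = scalePair-at-k' (copies-of-v-distinct v) s ρ

  scale-at-other : ∀ {v z} → v ≢ z → ∀ s ρ c → scale v s ρ (copy c z) ≡ ρ (copy c z)
  scale-at-other {v} v≢z s ρ c =
    scalePair-away (copies-of-v-distinct v) s ρ (copies-distinct c false (v≢z ∘ sym))
                   (copies-distinct c true (v≢z ∘ sym))

  scale-comm : ∀ {u w} → u ≢ w → ∀ λ' μ ρ x → scale u λ' (scale w μ ρ) x ≡ scale w μ (scale u λ' ρ) x
  scale-comm {u} {w} u≢w λ' μ ρ x with copyView x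
  ... | copy-of c z with z Fin.≟ u | z Fin.≟ w
  ...   | yes refl | _ =
    trans (scale-at-copy u λ' _ c)
          (trans (cong (λ' *_) (scale-at-other (u≢w ∘ sym) μ ρ c))
                 (sym (trans (scale-at-other (u≢w ∘ sym) μ _ c) (scale-at-copy u λ' ρ c))))
  ...   | no z≢u | yes refl =
    trans (scale-at-other (z≢u ∘ sym) λ' _ c)
          (trans (scale-at-copy w μ ρ c)
                 (sym (trans (scale-at-copy w μ _ c) (cong (μ *_) (scale-at-other (z≢u ∘ sym) λ' ρ c)))))
  ...   | no z≢u | no z≢w =
    trans (scale-at-other (z≢u ∘ sym) λ' _ c)
          (trans (scale-at-other (z≢w ∘ sym) μ ρ c)
                 (sym (trans (scale-at-other (z≢w ∘ sym) μ _ c) (scale-at-other (z≢u ∘ sym) λ' ρ c))))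

  binomial-scale : ∀ v w s ρ →
    binomial (QΛ t ε) (copy false w) (scale v s ρ) ≡ pow s (adjacency t v w) * binomial (QΛ t ε) (copy false w) ρ
  binomial-scale v w = binomial-scalePair (QΛ t ε) (copy false w) (QΛ-from-copies bip v w false) (QΛ-to-copies bip v w false)

  ratio : Fin (rank t) → Labels n → Carrier
  ratio v ρ = binomial (QΛ t ε) (copy false v) ρ * (ρ (copy false v) * ρ (copy true v)) ⁻¹

  ratio-pos : ∀ v {ρ} → Positive ρ → 0# < ratio v ρ
  ratio-pos v ρ-pos =
    *-pos _ _ (binomial-pos (QΛ t ε) (copy false v) ρ-pos) (⁻¹-pos (*-pos _ _ (ρ-pos _) (ρ-pos _)))

  ratio-cancel : ∀ v {ρ} → Positive ρ → ratio v ρ * (ρ (copy false v) * ρ (copy true v)) ≡ binomial (QΛ t ε) (copy false v) ρ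
  ratio-cancel v ρ-pos = *⁻¹-cancelʳ (pos⇒≢0 (*-pos _ _ (ρ-pos _) (ρ-pos _)))

  exchange-step : ∀ {v z} → v ≢ z → ∀ {ρ} → Positive ρ → ∀ {a a' b} → 0# < a →
    a' * a ≡ pow b (adjacency t z v) * ratio v ρ →
    ∀ x → exchangeΛ v (scale v a (scale z b ρ)) x ≡ scale v a' (scale z b ρ) x
  exchange-step {v} {z} v≢z {ρ} ρ-pos {a} {a'} {b} 0<a a'a≡ =
    exchange-scalePair (QΛ t ε) (copies-of-v-distinct v) ρ' 0<a
      (subst (0# <_) (sym (ρ'-at false)) (ρ-pos _)) (subst (0# <_) (sym (ρ'-at true)) (ρ-pos _))
      (begin
        a' * a * (ρ' v₁ * ρ' v₂)               ≡⟨ cong₂ (λ r r' → a' * a * (r * r')) (ρ'-at false) (ρ'-at true) ⟩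
        a' * a * (ρ v₁ * ρ v₂)                 ≡⟨ cong (_* (ρ v₁ * ρ v₂)) a'a≡ ⟩
        pow b δ * ratio v ρ * (ρ v₁ * ρ v₂)    ≡⟨ *-assoc _ _ _ ⟩
        pow b δ * (ratio v ρ * (ρ v₁ * ρ v₂))  ≡⟨ cong (pow b δ *_) (ratio-cancel v ρ-pos) ⟩
        pow b δ * binomial (QΛ t ε) v₁ ρ       ≡⟨ binomial-scale z v b ρ ⟨
        binomial (QΛ t ε) v₁ ρ'                ≡⟨ *-identityˡ _ ⟨
        1# * binomial (QΛ t ε) v₁ ρ'           ≡⟨ cong (λ k → pow a k * binomial (QΛ t ε) v₁ ρ') (adjacency-irrefl bip v) ⟨
        pow a (adjacency t v v) * binomial (QΛ t ε) v₁ ρ'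
                                               ≡⟨ binomial-scale v v a ρ' ⟨
        binomial (QΛ t ε) v₁ (scale v a ρ')    ∎)
    where
    open ≡-Reasoning
    v₁ v₂ : Fin n
    v₁ = copy false v
    v₂ = copy true v
    δ : ℕ
    δ = adjacency t z v
    ρ' : Labels n
    ρ' = scale z b ρ
    ρ'-at : ∀ c → ρ' (copy c v) ≡ ρ (copy c v)
    ρ'-at = scale-at-other (v≢z ∘ sym) b ρ

  adjacency-sym : ∀ v w → adjacency t v w ≡ adjacency t w v
  adjacency-sym v w = cong (if_then 1 else 0) (adjacent-sym t v w)

  -- δ is a parameter so that pow λ δ computes once δ is instantiated with 1 or 0.
  module Orbit {u w} (u≢w : u ≢ w) {ρ} (ρ-pos : Positive ρ) {δ} (adjacency≡δ : adjacency t u w ≡ δ) where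

    c d : Carrier
    c = ratio w ρ
    d = ratio u ρ

    0<c : 0# < c
    0<c = ratio-pos w ρ-pos

    0<d : 0# < d
    0<d = ratio-pos u ρ-pos

    scale-one : ∀ x → scale u 1# (scale w 1# ρ) x ≡ ρ x
    scale-one x = trans (scalePair-one _ _ _ x) (scalePair-one _ _ ρ x)

    coxeter-step : ∀ {ρ' λ' μ λ'' μ'} → 0# < λ' → 0# < μ →
      (∀ x → ρ' x ≡ scale u λ' (scale w μ ρ) x) →
      μ' * μ ≡ pow λ' δ * c → λ'' * λ' ≡ pow μ' δ * d →
      ∀ x → exchangeΛ u (exchangeΛ w ρ') x ≡ scale u λ'' (scale w μ' ρ) x
    coxeter-step {ρ'} {λ'} {μ} {λ''} {μ'} 0<λ' 0<μ ρ'≗ μ'μ≡ λ''λ'≡ x = begin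
      exchangeΛ u (exchangeΛ w ρ') x                 ≡⟨ exchangeΛ-cong u after-w x ⟩
      exchangeΛ u (scale u λ' (scale w μ' ρ)) x      ≡⟨ exchange-step u≢w ρ-pos 0<λ'
                                                          (trans λ''λ'≡ (cong (λ k → pow μ' k * d)
                                                                               (trans (sym adjacency≡δ) (adjacency-sym u w)))) x ⟩
      scale u λ'' (scale w μ' ρ) x                   ∎
      where
      open ≡-Reasoning
      after-w : ∀ y → exchangeΛ w ρ' y ≡ scale u λ' (scale w μ' ρ) y
      after-w y = begin
        exchangeΛ w ρ' y                             ≡⟨ exchangeΛ-cong w (λ z → trans (ρ'≗ z) (scale-comm u≢w λ' μ ρ z)) y ⟩
        exchangeΛ w (scale w μ (scale u λ' ρ)) y     ≡⟨ exchange-step (u≢w ∘ sym) ρ-pos 0<μ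
                                                          (trans μ'μ≡ (cong (λ k → pow λ' k * c) (sym adjacency≡δ))) y ⟩
        scale w μ' (scale u λ' ρ) y                  ≡⟨ scale-comm u≢w λ' μ' ρ y ⟨
        scale u λ' (scale w μ' ρ) y                  ∎

  period-adjacent : ∀ {u w} → u ≢ w → adjacent t u w ≡ true → ∀ {ρ} → Positive ρ →
    ∀ x → iterate 3 (coxeterElement u w) ρ x ≡ ρ x
  period-adjacent {u} {w} u≢w adj {ρ} ρ-pos x = trans (scaled-by-1-1 x) (scale-one x)
    where
    open Orbit u≢w ρ-pos (cong (if_then 1 else 0) adj)
    scaled-by-dc-c : ∀ x → iterate 1 (coxeterElement u w) ρ x ≡ scale u (d * c) (scale w c ρ) x
    scaled-by-dc-c = coxeter-step 0<1 0<1 (sym ∘ scale-one)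
      (solve 1 (λ c → c :* con 1 := con 1 :* con 1 :* c) refl c)
      (solve 2 (λ c d → d :* c :* con 1 := c :* con 1 :* d) refl c d)
    scaled-by-d-dc : ∀ x → iterate 2 (coxeterElement u w) ρ x ≡ scale u d (scale w (d * c) ρ) x
    scaled-by-d-dc = coxeter-step (*-pos _ _ 0<d 0<c) 0<c scaled-by-dc-c
      (solve 2 (λ c d → d :* c :* c := d :* c :* con 1 :* c) refl c d)
      (solve 2 (λ c d → d :* (d :* c) := d :* c :* con 1 :* d) refl c d)
    scaled-by-1-1 : ∀ x → iterate 3 (coxeterElement u w) ρ x ≡ scale u 1# (scale w 1# ρ) x
    scaled-by-1-1 = coxeter-step 0<d (*-pos _ _ 0<d 0<c) scaled-by-d-dc
      (solve 2 (λ c d → con 1 :* (d :* c) := d :* con 1 :* c) refl c d)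
      (solve 1 (λ d → con 1 :* d := con 1 :* con 1 :* d) refl d)

  period-nonadjacent : ∀ {u w} → u ≢ w → adjacent t u w ≡ false → ∀ {ρ} → Positive ρ →
    ∀ x → iterate 2 (coxeterElement u w) ρ x ≡ ρ x
  period-nonadjacent {u} {w} u≢w nonadj {ρ} ρ-pos x = trans (scaled-by-1-1 x) (scale-one x)
    where
    open Orbit u≢w ρ-pos (cong (if_then 1 else 0) nonadj)
    scaled-by-d-c : ∀ x → iterate 1 (coxeterElement u w) ρ x ≡ scale u d (scale w c ρ) x
    scaled-by-d-c = coxeter-step 0<1 0<1 (sym ∘ scale-one)
      (solve 1 (λ c → c :* con 1 := con 1 :* c) refl c)
      (solve 1 (λ d → d :* con 1 := con 1 :* d) refl d)
    scaled-by-1-1 : ∀ x → iterate 2 (coxeterElement u w) ρ x ≡ scale u 1# (scale w 1# ρ) x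
    scaled-by-1-1 = coxeter-step 0<d 0<c scaled-by-d-c refl refl

  coxeter-periodic : ∀ {u w} → u ≢ w → ∀ {ρ} → Positive ρ →
    ∀ x → iterate (coxeterOrder t u w) (coxeterElement u w) ρ x ≡ ρ x
  coxeter-periodic {u} {w} u≢w ρ-pos with adjacent t u w in adj
  ... | true  = period-adjacent u≢w adj ρ-pos
  ... | false = period-nonadjacent u≢w adj ρ-pos

theorem3p2 : (R : RealField) (t : ADE) (ε : Fin (rank t) → Bool) → IsBipartition t ε →
    (ρ : Fin (rank t ℕ.+ rank t) → RealField.Carrier R) →
    (∀ x → RealField._<_ R (RealField.0# R) (ρ x)) →
    (u w : Fin (rank t)) → u ≢ w →
    let result = iterate (coxeterOrder t u w) (Bar.μbar R t u ∘ Bar.μbar R t w) (QΛ t ε , ρ)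
    in (∀ x y → proj₁ result x y ≡ QΛ t ε x y) × (∀ x → proj₂ result x ≡ ρ x)
theorem3p2 R t ε bip ρ ρ-pos u w u≢w =
  proj₁ result≅ , λ x → trans (proj₂ result≅ x) (coxeter-periodic u≢w ρ-pos x)
  where
  open LabelDynamics R t ε bip
  result≅ : iterate (coxeterOrder t u w) (Bar.μbar R t u ∘ Bar.μbar R t w) (QΛ t ε , ρ)
              ≅Λ iterate (coxeterOrder t u w) (coxeterElement u w) ρ
  result≅ = iterate-≅Λ u w (coxeterOrder t u w) ((λ _ _ → refl) , (λ _ → refl))
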